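{- Let $V=\bigsqcup_{i=1}^n V_i$ be a finite set partitioned into pairwise disjoint subsets $V_1,\dots,V_n$, each of odd cardinality $|V_i|$. Let $G$ be a (simple) graph with vertex set $V$ such that each $V_i$ is an independent set in $G$, and for all $i\neq j$ the bipartite subgraph of $G$ induced on $V_i\sqcup V_j$ is Eulerian (i.e. all of its vertex degrees are even). Consider the subsets $U\subset V$ such that $|U\cap V_i|=1$ for all $i=1,\dots,n$ and the subgraph of $G$ induced on $U$ is Eulerian (all of its vertex degrees are even). Then the number of such subsets $U$ is odd.
   Context: Here a graph is called Eulerian if every vertex has even degree in it (connectivity is not required). -}

module Defs where

open import Data.Nat using (ℕ)
open import Data.Nat.Divisibility using (_∣_)
open import Data.Bool using (Bool; true; false)
open import Data.Fin using (Fin; _≟_)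
open import Data.Fin.Subset using (Subset; _∈_; _∩_; _∪_; ∣_∣)
open import Data.Vec using (tabulate)
open import Data.List using (List; length)
import Data.List.Membership.Propositional as LM
open import Data.List.Relation.Unary.Unique.Propositional using (Unique)
open import Data.Product using (_×_; Σ; ∃)
open import Function.Bundles using (_⇔_)
open import Relation.Binary.PropositionalEquality using (_≡_)
open import Relation.Nullary using (¬_)
open import Relation.Nullary.Decidable using (⌊_⌋)

Even : ℕ → Set
Even m = 2 ∣ m

Odd : ℕ → Set
Odd m = ¬ Even m

record SimpleGraph (N : ℕ) : Set where
  field
    adj   : Fin N → Fin N → Bool
    sym   : ∀ v w → adj v w ≡ adj w v
    irrefl : ∀ v → adj v v ≡ false
open SimpleGraph public

nbhd : ∀ {N} → SimpleGraph N → Fin N → Subset N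
nbhd G v = tabulate (adj G v)

degIn : ∀ {N} → SimpleGraph N → Subset N → Fin N → ℕ
degIn G S v = ∣ S ∩ nbhd G v ∣

InducedEulerian : ∀ {N} → SimpleGraph N → Subset N → Set
InducedEulerian G S = ∀ v → v ∈ S → Even (degIn G S v)

Independent : ∀ {N} → SimpleGraph N → Subset N → Set
Independent G S = ∀ v w → v ∈ S → w ∈ S → adj G v w ≡ false

block : ∀ {N n} → (Fin N → Fin n) → Fin n → Subset N
block part i = tabulate (λ v → ⌊ part v ≟ i ⌋)

HasCount : ∀ {A : Set} → (A → Set) → ℕ → Set
HasCount {A} P m = Σ (List A) λ L →
  Unique L × (∀ x → (x LM.∈ L) ⇔ P x) × length L ≡ m

module Submission where

-- Everything is counted modulo 2, with Booleans as the field 𝔽₂ (xor, ∧).  A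
-- transversal is represented by the list w of its vertices, taken block by block;
-- for a "defect" T : V → 𝔽₂, w is T-good if every vertex v of w has degree ≡ T v in
-- the subgraph induced on w.  T is balanced if it sums to 0 on every block.  The
-- main lemma (goodParity-odd) says: for any list of distinct blocks and any
-- balanced T, the number of T-good transversals is odd.  It is proved by induction
-- on the number of blocks and, inside, on the number of vertices where T is true:
--   * T = 0: peeling off the first block V_k, each choice q ∈ V_k leaves the shifted
--     defect "neighbourhood of q", which is balanced, so the count is |V_k| ≡ 1;
--   * T ≠ 0: switching T at two vertices x, y of one block does not change the
--     parity (move that block to the front, peel it, and use the induction
--     hypothesis), and it lowers the weight of T.
-- The handshake lemma is what makes the defect of the first vertex automatic.
-- Finally, good transversals for T = 0 are in bijection with the counted subsets.

open import Defs
open import Data.Nat using (ℕ)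
open import Data.Fin using (Fin)
open import Data.Fin.Subset using (Subset; _∩_; _∪_; ∣_∣)
open import Data.Product using (_×_; Σ)
open import Relation.Binary.PropositionalEquality using (_≡_)
open import Relation.Nullary using (¬_)

open import Algebra.Bundles using (CommutativeRing)
open import Data.Bool using (Bool; true; false; not; _∧_; _∨_; _xor_)
open import Data.Bool.Properties
  using (xor-∧-commutativeRing; xor-assoc; xor-same; xor-identityʳ; not-involutive; ¬-not;
         ∧-comm; ∧-zeroʳ; ∧-identityʳ; ∧-distribˡ-xor; ∧-distribʳ-xor)
  renaming (_≟_ to _≟ᵇ_)
open import Data.Empty using (⊥-elim)
open import Data.Fin using (zero; suc; _≟_)
import Data.Fin.Properties
open import Data.Fin.Properties using (any?)
open import Data.Fin.Subset using (⁅_⁆; ⊥) renaming (_∈_ to _∈ₛ_)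
open import Data.Fin.Subset.Properties
  using (⊆-antisym; x∈p∩q⁺; x∈p∩q⁻; x∈p∪q⁺; x∈⁅x⁆; x∈⁅y⁆⇒x≡y; ∣⁅x⁆∣≡1)
open import Data.List using (List; []; _∷_; _++_; map; foldr; filter; length; allFin; cartesianProductWith)
import Data.List.Properties as List
open import Data.List.Membership.Propositional using (_∈_; _∉_)
open import Data.List.Membership.Propositional.Properties
  using (∈-∃++; ∈-map⁺; ∈-map⁻; ∈-filter⁺; ∈-filter⁻; ∈-allFin;
         ∈-cartesianProductWith⁺; ∈-cartesianProductWith⁻)
open import Data.List.Relation.Binary.Permutation.Propositional
  using (_↭_; ↭⇒↭ₛ; ↭-sym; prep; swap) renaming (refl to ↭-refl; trans to ↭-trans)
import Data.List.Relation.Binary.Permutation.Propositional.Properties as Perm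
open import Data.List.Relation.Binary.Permutation.Setoid.Properties using (foldr-commMonoid; Unique-resp-↭)
open import Data.List.Relation.Unary.All as All using (All; []; _∷_)
open import Data.List.Relation.Unary.AllPairs as AllPairs using ([]; _∷_)
import Data.List.Relation.Unary.AllPairs.Properties as AllPairs
import Data.List.Relation.Unary.Any as Any
open import Data.List.Relation.Unary.Any using (here; there)
open import Data.List.Relation.Unary.Unique.Propositional using (Unique)
open import Data.List.Relation.Unary.Unique.Propositional.Properties
  using (Unique[x∷xs]⇒x∉xs; cartesianProductWith⁺; filter⁺; allFin⁺) renaming (map⁻ to Unique-map⁻)
open import Data.Nat using (zero; suc; _*_; _<_; s≤s)
open import Data.Nat.Divisibility using (divides)
open import Data.Nat.Properties using (≤-reflexive; ≤-refl; <-≤-trans; suc-injective)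
open import Data.Product using (_,_; proj₁; proj₂; ∃)
open import Data.Sum using (inj₁)
open import Data.Vec using (_∷_; []; lookup; tabulate)
open import Data.Vec.Properties using (lookup-zipWith; tabulate-cong; lookup∘tabulate; []=⇒lookup; lookup⇒[]=)
open import Function.Bundles using (_⇔_; mk⇔; Equivalence)
open import Relation.Binary.PropositionalEquality
  using (refl; cong; cong₂; subst; _≢_; module ≡-Reasoning)
import Relation.Binary.PropositionalEquality as ≡
open import Relation.Nullary using (Dec; yes; no; does)
open import Relation.Nullary.Decidable using (⌊_⌋; dec-true; dec-false)

module 𝔽₂ = CommutativeRing xor-∧-commutativeRing
open import Algebra.Properties.Semiring.Sum 𝔽₂.semiring
  using (sum; ∑-distrib-+; ∑-comm; *-distribˡ-sum; sum-cong-≗; sum-replicate-zero)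
open import Algebra.Properties.CommutativeSemigroup 𝔽₂.+-commutativeSemigroup
  using (interchange)
open import Algebra.Properties.CommutativeSemigroup 𝔽₂.*-commutativeSemigroup
  using () renaming (x∙yz≈y∙xz to ∧-swap)

isOdd : ℕ → Bool
isOdd zero    = false
isOdd (suc m) = not (isOdd m)

isOdd-even : ∀ m → Even m → isOdd m ≡ false
isOdd-even m (divides q refl) = doubled q
  where
  doubled : ∀ q → isOdd (q * 2) ≡ false
  doubled zero    = refl
  doubled (suc q) = ≡.trans (not-involutive _) (doubled q)

even-isOdd : ∀ m → isOdd m ≡ false → Even m
even-isOdd zero          _ = divides 0 refl
even-isOdd (suc zero)    ()
even-isOdd (suc (suc m)) e with even-isOdd m (≡.trans (≡.sym (not-involutive _)) e)
... | divides q refl = divides (suc q) refl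

odd-isOdd : ∀ m → Odd m → isOdd m ≡ true
odd-isOdd m odd with isOdd m in eq
... | true  = refl
... | false = ⊥-elim (odd (even-isOdd m eq))

isOdd-odd : ∀ m → isOdd m ≡ true → Odd m
isOdd-odd m e even with ≡.trans (≡.sym e) (isOdd-even m even)
... | ()

xor≡false⇒≡ : ∀ {a b} → a xor b ≡ false → a ≡ b
xor≡false⇒≡ {false} {false} _ = refl
xor≡false⇒≡ {true}  {true}  _ = refl

does⇔ : ∀ {A : Set} (a? : Dec A) → (does a? ≡ true) ⇔ A
does⇔ (yes a) = mk⇔ (λ _ → a) (λ _ → refl)
does⇔ (no ¬a) = mk⇔ (λ ()) (λ a → ⊥-elim (¬a a))

⌊⌋≡does : ∀ {A : Set} (a? : Dec A) → ⌊ a? ⌋ ≡ does a?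
⌊⌋≡does (yes _) = refl
⌊⌋≡does (no _)  = refl

does-cong : ∀ {A B : Set} (a? : Dec A) (b? : Dec B) → (A → B) → (B → A) → does a? ≡ does b?
does-cong (yes a) (yes b) f g = refl
does-cong (yes a) (no ¬b) f g = ⊥-elim (¬b (f a))
does-cong (no ¬a) (yes b) f g = ⊥-elim (¬a (g b))
does-cong (no ¬a) (no ¬b) f g = refl

xor-cancel : ∀ a b → a xor (a xor b) ≡ b
xor-cancel a b = ≡.trans (≡.sym (xor-assoc a a b)) (cong (_xor b) (xor-same a))

does-≟-xor : ∀ s a b → does (s ≟ᵇ a) xor does (s ≟ᵇ b) ≡ a xor b
does-≟-xor false false false = refl
does-≟-xor false false true  = refl
does-≟-xor false true  false = refl
does-≟-xor false true  true  = refl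
does-≟-xor true  false false = refl
does-≟-xor true  false true  = refl
does-≟-xor true  true  false = refl
does-≟-xor true  true  true  = refl

∧-guard : ∀ {G : Set} (g? : Dec G) {b c} → (G → b ≡ c) → b ∧ does g? ≡ c ∧ does g?
∧-guard (yes g) e = cong (_∧ true) (e g)
∧-guard (no _)  e = ≡.trans (∧-zeroʳ _) (≡.sym (∧-zeroʳ _))

∧-true : ∀ {a b} → a ∧ b ≡ true → a ≡ true × b ≡ true
∧-true {true} {true} _ = refl , refl

sumL : {A : Set} → List A → (A → Bool) → Bool
sumL xs f = foldr _xor_ false (map f xs)

module _ {A : Set} where

  sumL-cong : ∀ (xs : List A) {f g : A → Bool} → (∀ {a} → a ∈ xs → f a ≡ g a) →
              sumL xs f ≡ sumL xs g
  sumL-cong []       e = refl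
  sumL-cong (a ∷ xs) e = cong₂ _xor_ (e (here refl)) (sumL-cong xs (λ m → e (there m)))

  sumL-xor : ∀ (xs : List A) f g → sumL xs (λ a → f a xor g a) ≡ sumL xs f xor sumL xs g
  sumL-xor []       f g = refl
  sumL-xor (a ∷ xs) f g =
    ≡.trans (cong ((f a xor g a) xor_) (sumL-xor xs f g)) (interchange (f a) (g a) _ _)

  sumL-scale : ∀ (xs : List A) b f → b ∧ sumL xs f ≡ sumL xs (λ a → b ∧ f a)
  sumL-scale []       b f = ∧-zeroʳ b
  sumL-scale (a ∷ xs) b f =
    ≡.trans (∧-distribˡ-xor b (f a) _) (cong ((b ∧ f a) xor_) (sumL-scale xs b f))

  sumL-zero : ∀ (xs : List A) → sumL xs (λ _ → false) ≡ false
  sumL-zero []       = refl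
  sumL-zero (a ∷ xs) = sumL-zero xs

  sumL-++ : ∀ (xs ys : List A) f → sumL (xs ++ ys) f ≡ sumL xs f xor sumL ys f
  sumL-++ []       ys f = refl
  sumL-++ (a ∷ xs) ys f = ≡.trans (cong (f a xor_) (sumL-++ xs ys f)) (≡.sym (xor-assoc (f a) _ _))

  sumL-↭ : ∀ {xs ys : List A} f → xs ↭ ys → sumL xs f ≡ sumL ys f
  sumL-↭ f p = foldr-commMonoid 𝔽₂.setoid 𝔽₂.+-isCommutativeMonoid (↭⇒↭ₛ (Perm.map⁺ f p))

  sumL-filter : ∀ {P : A → Set} (P? : ∀ a → Dec (P a)) xs f →
                sumL (filter P? xs) f ≡ sumL xs (λ a → does (P? a) ∧ f a)
  sumL-filter P? []       f = refl
  sumL-filter P? (a ∷ xs) f with does (P? a)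
  ... | true  = cong (f a xor_) (sumL-filter P? xs f)
  ... | false = sumL-filter P? xs f

sumL-map : ∀ {A B : Set} (h : A → B) xs (f : B → Bool) → sumL (map h xs) f ≡ sumL xs (λ a → f (h a))
sumL-map h []       f = refl
sumL-map h (a ∷ xs) f = cong (f (h a) xor_) (sumL-map h xs f)

module _ {A B C : Set} where

  sumL-cartesian : ∀ (h : A → B → C) xs ys f →
    sumL (cartesianProductWith h xs ys) f ≡ sumL xs (λ a → sumL ys (λ b → f (h a b)))
  sumL-cartesian h []       ys f = refl
  sumL-cartesian h (a ∷ xs) ys f = begin
    sumL (map (h a) ys ++ cartesianProductWith h xs ys) f
      ≡⟨ sumL-++ (map (h a) ys) _ f ⟩
    sumL (map (h a) ys) f xor sumL (cartesianProductWith h xs ys) f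
      ≡⟨ cong₂ _xor_ (sumL-map (h a) ys f) (sumL-cartesian h xs ys f) ⟩
    sumL ys (λ b → f (h a b)) xor sumL xs (λ a → sumL ys (λ b → f (h a b))) ∎
    where open ≡-Reasoning

sumL-allFin : ∀ N (f : Fin N → Bool) → sumL (allFin N) f ≡ sum f
sumL-allFin N f = go N (λ v → v)
  where
  go : ∀ M (g : Fin M → Fin N) → sumL (Data.List.tabulate g) f ≡ sum (λ v → f (g v))
  go zero    g = refl
  go (suc M) g = cong (f (g zero) xor_) (go M (λ v → g (suc v)))

∑-δ : ∀ {N} (g : Fin N → Bool) x → sum (λ v → g v ∧ does (v ≟ x)) ≡ g x
∑-δ {suc N} g zero = begin
  g zero ∧ true xor sum (λ v → g (suc v) ∧ false)
    ≡⟨ cong₂ _xor_ (∧-identityʳ (g zero)) (≡.trans (sum-cong-≗ (λ v → ∧-zeroʳ (g (suc v)))) (sum-replicate-zero N)) ⟩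
  g zero xor false ≡⟨ xor-identityʳ (g zero) ⟩
  g zero ∎
  where open ≡-Reasoning
∑-δ {suc N} g (suc x) = ≡.trans (cong (_xor sum (λ v → g (suc v) ∧ does (v ≟ x))) (∧-zeroʳ (g zero)))
                                (∑-δ (λ v → g (suc v)) x)

sum-witness : ∀ {N} (h : Fin N → Bool) → sum h ≡ true → ∃ λ y → h y ≡ true
sum-witness {suc N} h s with h zero in e
... | true  = zero , e
... | false = let (y , hy) = sum-witness (λ v → h (suc v)) s in suc y , hy

sum-partner : ∀ {N} (h : Fin N → Bool) x → sum h ≡ false → h x ≡ true →
              ∃ λ y → y ≢ x × h y ≡ true
sum-partner {suc N} h zero s hx rewrite hx =
  let (y , hy) = sum-witness (λ v → h (suc v)) (not-false s) in suc y , (λ ()) , hy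
  where
  not-false : ∀ {b} → not b ≡ false → b ≡ true
  not-false {true} _ = refl
sum-partner {suc N} h (suc x) s hx with h zero in e
... | true  = zero , (λ ()) , e
... | false = let (y , y≢x , hy) = sum-partner (λ v → h (suc v)) x s hx in
              suc y , (λ eq → y≢x (Data.Fin.Properties.suc-injective eq)) , hy

isOdd-∣∣ : ∀ {N} (p : Subset N) → isOdd ∣ p ∣ ≡ sum (lookup p)
isOdd-∣∣ []          = refl
isOdd-∣∣ (true ∷ p)  = cong not (isOdd-∣∣ p)
isOdd-∣∣ (false ∷ p) = isOdd-∣∣ p

isOdd-∣∩∣ : ∀ {N} (p q : Subset N) → isOdd ∣ p ∩ q ∣ ≡ sum (λ v → lookup p v ∧ lookup q v)
isOdd-∣∩∣ p q = ≡.trans (isOdd-∣∣ (p ∩ q)) (sum-cong-≗ (λ v → lookup-zipWith _∧_ v p q))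

∣p∣≡1⇒singleton : ∀ {N} (p : Subset N) → ∣ p ∣ ≡ 1 → ∃ λ x → p ≡ ⁅ x ⁆
∣p∣≡1⇒singleton (true ∷ p)  e = zero , cong (true ∷_) (empty p (suc-injective e))
  where
  empty : ∀ {N} (p : Subset N) → ∣ p ∣ ≡ 0 → p ≡ ⊥
  empty []          _ = refl
  empty (false ∷ p) e = cong (false ∷_) (empty p e)
∣p∣≡1⇒singleton (false ∷ p) e = let (x , p≡⁅x⁆) = ∣p∣≡1⇒singleton p e in suc x , cong (false ∷_) p≡⁅x⁆

isOdd-filter : ∀ {A : Set} {P : A → Set} (P? : ∀ a → Dec (P a)) xs →
               isOdd (length (filter P? xs)) ≡ sumL xs (λ a → does (P? a))
isOdd-filter P? []       = refl
isOdd-filter P? (a ∷ xs) with does (P? a)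
... | true  = cong not (isOdd-filter P? xs)
... | false = isOdd-filter P? xs

∈-tabulate : ∀ {N} {f : Fin N → Bool} {x} → x ∈ₛ tabulate f ⇔ f x ≡ true
∈-tabulate {f = f} {x} = mk⇔
  (λ m → ≡.trans (≡.sym (lookup∘tabulate f x)) ([]=⇒lookup m))
  (λ e → lookup⇒[]= x _ (≡.trans (lookup∘tabulate f x) e))

_∈?_ : ∀ {N} (u : Fin N) (w : List (Fin N)) → Dec (u ∈ w)
u ∈? w = Any.any? (u ≟_) w

toSubset : ∀ {N} → List (Fin N) → Subset N
toSubset w = tabulate (λ u → does (u ∈? w))

∈-toSubset : ∀ {N} {w : List (Fin N)} {u} → u ∈ₛ toSubset w ⇔ u ∈ w
∈-toSubset {w = w} {u} = mk⇔
  (λ m → Equivalence.to (does⇔ (u ∈? w)) (Equivalence.to ∈-tabulate m))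
  (λ m → Equivalence.from ∈-tabulate (Equivalence.from (does⇔ (u ∈? w)) m))

sum-toSubset : ∀ {N} (w : List (Fin N)) → Unique w → (g : Fin N → Bool) →
               sum (λ u → lookup (toSubset w) u ∧ g u) ≡ sumL w g
sum-toSubset {N} w uw g =
  ≡.trans (sum-cong-≗ (λ u → cong (_∧ g u) (lookup∘tabulate _ u))) (sum-∈ w uw)
  where
  sum-∈ : ∀ w → Unique w → sum (λ u → does (u ∈? w) ∧ g u) ≡ sumL w g
  sum-∈ []       _         = sum-replicate-zero N
  sum-∈ (a ∷ w) (a∉ ∷ uw) = begin
    sum (λ u → (does (u ≟ a) ∨ does (u ∈? w)) ∧ g u)
      ≡⟨ sum-cong-≗ (λ u → ≡.trans (cong (_∧ g u) (∨⇒xor u)) (∧-distribʳ-xor (g u) (does (u ≟ a)) (does (u ∈? w)))) ⟩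
    sum (λ u → (does (u ≟ a) ∧ g u) xor (does (u ∈? w) ∧ g u))
      ≡⟨ ∑-distrib-+ (λ u → does (u ≟ a) ∧ g u) _ ⟩
    sum (λ u → does (u ≟ a) ∧ g u) xor sum (λ u → does (u ∈? w) ∧ g u)
      ≡⟨ cong₂ _xor_ (≡.trans (sum-cong-≗ (λ u → ∧-comm _ (g u))) (∑-δ g a)) (sum-∈ w uw) ⟩
    g a xor sumL w g ∎
    where
    open ≡-Reasoning
    a∉w : a ∉ w
    a∉w = Unique[x∷xs]⇒x∉xs (a∉ ∷ uw)
    ∨⇒xor : ∀ u → does (u ≟ a) ∨ does (u ∈? w) ≡ does (u ≟ a) xor does (u ∈? w)
    ∨⇒xor u with u ≟ a
    ... | yes refl rewrite dec-false (u ∈? w) a∉w = refl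
    ... | no _     = refl

map-unique-injective : ∀ {A B : Set} (f : A → B) {xs} → Unique (map f xs) →
                       ∀ {x y} → x ∈ xs → y ∈ xs → f x ≡ f y → x ≡ y
map-unique-injective f (fa∉ ∷ u) (here refl) (here refl) _ = refl
map-unique-injective f (fa∉ ∷ u) (here refl) (there y∈) e = ⊥-elim (All.lookup fa∉ (∈-map⁺ f y∈) e)
map-unique-injective f (fa∉ ∷ u) (there x∈) (here refl) e = ⊥-elim (All.lookup fa∉ (∈-map⁺ f x∈) (≡.sym e))
map-unique-injective f (fa∉ ∷ u) (there x∈) (there y∈) e = map-unique-injective f u x∈ y∈ e

same-entries : ∀ {A B : Set} (f : A → B) {xs ys} → map f xs ≡ map f ys → Unique (map f xs) →
               (∀ {a} → a ∈ xs → a ∈ ys) → xs ≡ ys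
same-entries f {[]}     {[]}     _ _ _ = refl
same-entries f {a ∷ xs} {b ∷ ys} e u@(fa∉ ∷ u′) xs⊆ys =
  cong₂ _∷_ a≡b (same-entries f (List.∷-injectiveʳ e) u′ tail⊆)
  where
  a≡b : a ≡ b
  a≡b = map-unique-injective f (subst Unique e u) (xs⊆ys (here refl)) (here refl) (List.∷-injectiveˡ e)
  tail⊆ : ∀ {c} → c ∈ xs → c ∈ ys
  tail⊆ c∈xs with xs⊆ys (there c∈xs)
  ... | here refl = ⊥-elim (All.lookup fa∉ (∈-map⁺ f c∈xs) (cong f a≡b))
  ... | there c∈ys = c∈ys

AllPairs-strengthen : ∀ {A : Set} {P : A → Set} {R S : A → A → Set} →
  (∀ {x y} → P x → P y → R x y → S x y) → ∀ {xs} → All P xs → AllPairs.AllPairs R xs → AllPairs.AllPairs S xs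
AllPairs-strengthen f []         []         = []
AllPairs-strengthen f (px ∷ pxs) (rx ∷ rxs) =
  All.zipWith (λ (py , r) → f px py r) (pxs , rx) ∷ AllPairs-strengthen f pxs rxs

weight : ∀ {N} → (Fin N → Bool) → ℕ
weight T = ∣ tabulate T ∣

toggle : ∀ {N} → Fin N → (Fin N → Bool) → Fin N → Bool
toggle x T v = T v xor does (v ≟ x)

weight-toggle : ∀ {N} (T : Fin N → Bool) x → T x ≡ true → weight (toggle x T) < weight T
weight-toggle {suc N} T zero Tx rewrite Tx =
  s≤s (≤-reflexive (cong ∣_∣ (tabulate-cong (λ v → xor-identityʳ (T (suc v))))))
weight-toggle {suc N} T (suc x) Tx with T zero
... | true  = s≤s (weight-toggle (λ v → T (suc v)) x Tx)
... | false = weight-toggle (λ v → T (suc v)) x Tx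

flipPair : ∀ {N} → Fin N → Fin N → (Fin N → Bool) → Fin N → Bool
flipPair x y T v = T v xor (does (v ≟ x) xor does (v ≟ y))

weight-flipPair : ∀ {N} (T : Fin N → Bool) {x y} → T x ≡ true → T y ≡ true → y ≢ x →
                  weight (flipPair x y T) < weight T
weight-flipPair T {x} {y} Tx Ty y≢x = begin-strict
  weight (flipPair x y T)      ≡⟨ cong ∣_∣ (tabulate-cong (λ v → ≡.sym (xor-assoc (T v) _ _))) ⟩
  weight (toggle y (toggle x T)) <⟨ weight-toggle (toggle x T) y Txy ⟩
  weight (toggle x T)          <⟨ weight-toggle T x Tx ⟩
  weight T                     ∎
  where
  open Data.Nat.Properties.≤-Reasoning
  Txy : toggle x T y ≡ true
  Txy rewrite dec-false (y ≟ x) y≢x | Ty = refl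

flipPair-away : ∀ {N} (T : Fin N → Bool) {x y v} → v ≢ x → v ≢ y → flipPair x y T v ≡ T v
flipPair-away T {x} {y} {v} v≢x v≢y
  rewrite dec-false (v ≟ x) v≢x | dec-false (v ≟ y) v≢y = xor-identityʳ (T v)

module Transversals {N n : ℕ} (part : Fin N → Fin n) where

  inBlock : Fin n → Fin N → Bool
  inBlock k v = does (part v ≟ k)

  Balanced : (Fin N → Bool) → Set
  Balanced T = ∀ k → sum (λ v → inBlock k v ∧ T v) ≡ false

  Balanced-zero : Balanced (λ _ → false)
  Balanced-zero k = ≡.trans (sum-cong-≗ (λ v → ∧-zeroʳ (inBlock k v))) (sum-replicate-zero N)

  Balanced-xor : ∀ {S T} → Balanced S → Balanced T → Balanced (λ v → S v xor T v)
  Balanced-xor {S} {T} bS bT k = begin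
    sum (λ v → inBlock k v ∧ (S v xor T v))
      ≡⟨ sum-cong-≗ (λ v → ∧-distribˡ-xor (inBlock k v) (S v) (T v)) ⟩
    sum (λ v → (inBlock k v ∧ S v) xor (inBlock k v ∧ T v))
      ≡⟨ ∑-distrib-+ (λ v → inBlock k v ∧ S v) _ ⟩
    sum (λ v → inBlock k v ∧ S v) xor sum (λ v → inBlock k v ∧ T v)
      ≡⟨ cong₂ _xor_ (bS k) (bT k) ⟩
    false ∎
    where open ≡-Reasoning

  Balanced-pair : ∀ {x y} → part x ≡ part y → Balanced (λ v → does (v ≟ x) xor does (v ≟ y))
  Balanced-pair {x} {y} pxy k = begin
    sum (λ v → inBlock k v ∧ (does (v ≟ x) xor does (v ≟ y)))
      ≡⟨ sum-cong-≗ (λ v → ∧-distribˡ-xor (inBlock k v) (does (v ≟ x)) (does (v ≟ y))) ⟩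
    sum (λ v → (inBlock k v ∧ does (v ≟ x)) xor (inBlock k v ∧ does (v ≟ y)))
      ≡⟨ ∑-distrib-+ (λ v → inBlock k v ∧ does (v ≟ x)) _ ⟩
    sum (λ v → inBlock k v ∧ does (v ≟ x)) xor sum (λ v → inBlock k v ∧ does (v ≟ y))
      ≡⟨ cong₂ _xor_ (∑-δ (inBlock k) x) (∑-δ (inBlock k) y) ⟩
    inBlock k x xor inBlock k y
      ≡⟨ cong (λ p → does (p ≟ k) xor inBlock k y) pxy ⟩
    inBlock k y xor inBlock k y
      ≡⟨ xor-same (inBlock k y) ⟩
    false ∎
    where open ≡-Reasoning

  Balanced-partner : ∀ {T} → Balanced T → ∀ {x} → T x ≡ true →
                     ∃ λ y → y ≢ x × part y ≡ part x × T y ≡ true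
  Balanced-partner {T} bT {x} Tx =
    let (y , y≢x , hy) = sum-partner (λ v → inBlock (part x) v ∧ T v) x (bT (part x)) hx
        (yBlock , Ty)  = ∧-true hy
    in y , y≢x , Equivalence.to (does⇔ (part y ≟ part x)) yBlock , Ty
    where
    hx : inBlock (part x) x ∧ T x ≡ true
    hx rewrite dec-true (part x ≟ part x) refl = Tx

  members : Fin n → List (Fin N)
  members k = filter (λ v → part v ≟ k) (allFin N)

  transversals : List (Fin n) → List (List (Fin N))
  transversals []       = [] ∷ []
  transversals (k ∷ ps) = cartesianProductWith _∷_ (members k) (transversals ps)

  ∈-transversals : ∀ ps {w} → w ∈ transversals ps ⇔ map part w ≡ ps
  ∈-transversals ps = mk⇔ (to ps) from
    where
    to : ∀ ps {w} → w ∈ transversals ps → map part w ≡ ps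
    to []       (here refl) = refl
    to (k ∷ ps) m with ∈-cartesianProductWith⁻ _∷_ (members k) (transversals ps) m
    ... | v , w , v∈k , w∈ps , refl =
      cong₂ _∷_ (proj₂ (∈-filter⁻ (λ v → part v ≟ k) {xs = allFin N} v∈k)) (to ps w∈ps)
    own : ∀ w → w ∈ transversals (map part w)
    own []      = here refl
    own (v ∷ w) = ∈-cartesianProductWith⁺ _∷_ (∈-filter⁺ (λ v → part v ≟ _) (∈-allFin v) refl) (own w)
    from : ∀ {w} → map part w ≡ ps → w ∈ transversals ps
    from {w} refl = own w

  transversals-unique : ∀ ps → Unique (transversals ps)
  transversals-unique []       = All.[] ∷ []
  transversals-unique (k ∷ ps) = cartesianProductWith⁺ _∷_ List.∷-injective
    (filter⁺ (λ v → part v ≟ k) (allFin⁺ N)) (transversals-unique ps)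

  ∑tr : List (Fin n) → (List (Fin N) → Bool) → Bool
  ∑tr ps f = sumL (transversals ps) f

  ∑tr-∷ : ∀ k ps f → ∑tr (k ∷ ps) f ≡ sum (λ q → inBlock k q ∧ ∑tr ps (λ w → f (q ∷ w)))
  ∑tr-∷ k ps f = begin
    sumL (cartesianProductWith _∷_ (members k) (transversals ps)) f
      ≡⟨ sumL-cartesian _∷_ (members k) (transversals ps) f ⟩
    sumL (members k) (λ q → ∑tr ps (λ w → f (q ∷ w)))
      ≡⟨ sumL-filter (λ v → part v ≟ k) (allFin N) _ ⟩
    sumL (allFin N) (λ q → inBlock k q ∧ ∑tr ps (λ w → f (q ∷ w)))
      ≡⟨ sumL-allFin N _ ⟩
    sum (λ q → inBlock k q ∧ ∑tr ps (λ w → f (q ∷ w))) ∎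
    where open ≡-Reasoning

  ∑tr-cong : ∀ ps {f g} → (∀ {w} → map part w ≡ ps → f w ≡ g w) → ∑tr ps f ≡ ∑tr ps g
  ∑tr-cong ps e = sumL-cong (transversals ps) (λ m → e (Equivalence.to (∈-transversals ps) m))

  ∑tr-↭ : ∀ {ps ps'} (f : List (Fin N) → Bool) → (∀ {w w'} → w ↭ w' → f w ≡ f w') →
          ps ↭ ps' → ∑tr ps f ≡ ∑tr ps' f
  ∑tr-↭ f f-↭ ↭-refl = refl
  ∑tr-↭ f f-↭ (↭-trans p q) = ≡.trans (∑tr-↭ f f-↭ p) (∑tr-↭ f f-↭ q)
  ∑tr-↭ f f-↭ (prep {xs} {ys} k p) = begin
    ∑tr (k ∷ xs) f
      ≡⟨ ∑tr-∷ k xs f ⟩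
    sum (λ q → inBlock k q ∧ ∑tr xs (λ w → f (q ∷ w)))
      ≡⟨ sum-cong-≗ (λ q → cong (inBlock k q ∧_) (∑tr-↭ _ (λ r → f-↭ (prep q r)) p)) ⟩
    sum (λ q → inBlock k q ∧ ∑tr ys (λ w → f (q ∷ w)))
      ≡⟨ ∑tr-∷ k ys f ⟨
    ∑tr (k ∷ ys) f ∎
    where open ≡-Reasoning
  ∑tr-↭ f f-↭ (swap {xs} {ys} k l p) = begin
    ∑tr (k ∷ l ∷ xs) f
      ≡⟨ ∑tr-∷∷ k l xs f ⟩
    sum (λ a → sum (λ b → inBlock k a ∧ (inBlock l b ∧ ∑tr xs (λ w → f (a ∷ b ∷ w)))))
      ≡⟨ ∑-comm (λ a b → inBlock k a ∧ (inBlock l b ∧ ∑tr xs (λ w → f (a ∷ b ∷ w)))) ⟩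
    sum (λ b → sum (λ a → inBlock k a ∧ (inBlock l b ∧ ∑tr xs (λ w → f (a ∷ b ∷ w)))))
      ≡⟨ sum-cong-≗ (λ b → sum-cong-≗ (λ a → ≡.trans (∧-swap (inBlock k a) (inBlock l b) _)
           (cong (λ s → inBlock l b ∧ (inBlock k a ∧ s)) (exchange a b)))) ⟩
    sum (λ b → sum (λ a → inBlock l b ∧ (inBlock k a ∧ ∑tr ys (λ w → f (b ∷ a ∷ w)))))
      ≡⟨ ∑tr-∷∷ l k ys f ⟨
    ∑tr (l ∷ k ∷ ys) f ∎
    where
    open ≡-Reasoning
    ∑tr-∷∷ : ∀ k l ps f → ∑tr (k ∷ l ∷ ps) f ≡
             sum (λ a → sum (λ b → inBlock k a ∧ (inBlock l b ∧ ∑tr ps (λ w → f (a ∷ b ∷ w)))))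
    ∑tr-∷∷ k l ps f = ≡.trans (∑tr-∷ k (l ∷ ps) f) (sum-cong-≗ (λ a →
      ≡.trans (cong (inBlock k a ∧_) (∑tr-∷ l ps _)) (*-distribˡ-sum (inBlock k a) (λ b → inBlock l b ∧ ∑tr ps (λ w → f (a ∷ b ∷ w))))))
    exchange : ∀ a b → ∑tr xs (λ w → f (a ∷ b ∷ w)) ≡ ∑tr ys (λ w → f (b ∷ a ∷ w))
    exchange a b = ≡.trans (∑tr-↭ _ (λ r → f-↭ (prep a (prep b r))) p)
                           (∑tr-cong ys (λ _ → f-↭ (swap a b ↭-refl)))

module GoodTransversals {N n : ℕ} (part : Fin N → Fin n) (adj : Fin N → Fin N → Bool)
  (adj-sym : ∀ v w → adj v w ≡ adj w v) (adj-irrefl : ∀ v → adj v v ≡ false) where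

  open Transversals part

  deg : List (Fin N) → Fin N → Bool
  deg w v = sumL w (adj v)

  handshake : ∀ w → sumL w (deg w) ≡ false
  handshake []      = refl
  handshake (a ∷ w) = begin
    (adj a a xor deg w a) xor sumL w (λ v → adj v a xor deg w v)
      ≡⟨ cong₂ _xor_ (cong (_xor deg w a) (adj-irrefl a)) (sumL-xor w (λ v → adj v a) (deg w)) ⟩
    deg w a xor (sumL w (λ v → adj v a) xor sumL w (deg w))
      ≡⟨ cong₂ (λ s t → deg w a xor (s xor t)) (sumL-cong w (λ {v} _ → adj-sym v a)) (handshake w) ⟩
    deg w a xor (deg w a xor false)
      ≡⟨ xor-cancel (deg w a) false ⟩
    false ∎
    where open ≡-Reasoning

  Good : (Fin N → Bool) → List (Fin N) → Set
  Good T w = All (λ v → deg w v ≡ T v) w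

  good? : ∀ T w → Dec (Good T w)
  good? T w = All.all? (λ v → deg w v ≟ᵇ T v) w

  good : (Fin N → Bool) → List (Fin N) → Bool
  good T w = does (good? T w)

  good-cong : ∀ {T T'} w → (∀ {v} → v ∈ w → T v ≡ T' v) → good T w ≡ good T' w
  good-cong w e = does-cong (good? _ w) (good? _ w)
    (λ g → All.tabulate (λ m → ≡.trans (All.lookup g m) (e m)))
    (λ g → All.tabulate (λ m → ≡.trans (All.lookup g m) (≡.sym (e m))))

  good-↭ : ∀ {T w w'} → w ↭ w' → good T w ≡ good T w'
  good-↭ {T} {w} {w'} p = does-cong (good? T w) (good? T w')
    (λ g → Perm.All-resp-↭ p (All.map (λ {v} e → ≡.trans (sumL-↭ (adj v) (↭-sym p)) e) g))
    (λ g → Perm.All-resp-↭ (↭-sym p) (All.map (λ {v} e → ≡.trans (sumL-↭ (adj v) p) e) g))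

  -- once q is chosen, the remaining vertices see the defect shifted by the neighbours of q
  shift : Fin N → (Fin N → Bool) → Fin N → Bool
  shift q T v = adj q v xor T v

  deg-shift : ∀ {T q w} → Good (shift q T) w → deg w q ≡ sumL w T
  deg-shift {T} {q} {w} g = xor≡false⇒≡ (begin
    deg w q xor sumL w T ≡⟨ sumL-xor w (adj q) T ⟨
    sumL w (shift q T)   ≡⟨ sumL-cong w (All.lookup g) ⟨
    sumL w (deg w)       ≡⟨ handshake w ⟩
    false                ∎)
    where open ≡-Reasoning

  good-∷ : ∀ T q w → good T (q ∷ w) ≡ does (sumL w T ≟ᵇ T q) ∧ good (shift q T) w
  good-∷ T q w = ≡.trans (cong (does (deg (q ∷ w) q ≟ᵇ T q) ∧_) rest)
    (∧-guard (good? (shift q T) w)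
      (λ g → cong (λ d → does (d ≟ᵇ T q)) (≡.trans (cong (_xor deg w q) (adj-irrefl q)) (deg-shift g))))
    where
    transpose : ∀ {v d t} → adj v q xor d ≡ t ⇔ d ≡ adj q v xor t
    transpose {v} {d} {t} rewrite adj-sym v q = mk⇔
      (λ e → ≡.trans (≡.sym (xor-cancel (adj q v) d)) (cong (adj q v xor_) e))
      (λ e → ≡.trans (cong (adj q v xor_) e) (xor-cancel (adj q v) t))
    rest : does (All.all? (λ v → deg (q ∷ w) v ≟ᵇ T v) w) ≡ good (shift q T) w
    rest = does-cong (All.all? (λ v → deg (q ∷ w) v ≟ᵇ T v) w) (good? (shift q T) w)
      (All.map (Equivalence.to transpose)) (All.map (Equivalence.from transpose))

  noDefect : Fin N → Bool
  noDefect _ = false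

  goodParity : List (Fin n) → (Fin N → Bool) → Bool
  goodParity ps T = ∑tr ps (good T)

  OddForBalanced : List (Fin n) → Set
  OddForBalanced ps = ∀ T → Balanced T → goodParity ps T ≡ true

  module _ (block-odd : ∀ k → sum (inBlock k) ≡ true)
           (nbhd-balanced : ∀ q → Balanced (adj q)) where

    Balanced-shift : ∀ {T} q → Balanced T → Balanced (shift q T)
    Balanced-shift q bT = Balanced-xor (nbhd-balanced q) bT

    -- with no defect, adding the block k multiplies the parity by |V_k| ≡ 1
    goodParity-zero : ∀ k ps → OddForBalanced ps → goodParity (k ∷ ps) noDefect ≡ true
    goodParity-zero k ps ih = begin
      goodParity (k ∷ ps) noDefect
        ≡⟨ ∑tr-∷ k ps (good noDefect) ⟩
      sum (λ q → inBlock k q ∧ ∑tr ps (λ w → good noDefect (q ∷ w)))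
        ≡⟨ sum-cong-≗ (λ q → cong (inBlock k q ∧_) (peel q)) ⟩
      sum (λ q → inBlock k q ∧ true)
        ≡⟨ sum-cong-≗ (λ q → ∧-identityʳ (inBlock k q)) ⟩
      sum (inBlock k)
        ≡⟨ block-odd k ⟩
      true ∎
      where
      open ≡-Reasoning
      peel : ∀ q → ∑tr ps (λ w → good noDefect (q ∷ w)) ≡ true
      peel q = ≡.trans
        (∑tr-cong ps (λ {w} _ → ≡.trans (good-∷ noDefect q w)
          (cong (λ s → does (s ≟ᵇ false) ∧ good (shift q noDefect) w) (sumL-zero w))))
        (ih (shift q noDefect) (Balanced-shift q Balanced-zero))

    peel-difference : ∀ ps → OddForBalanced ps → ∀ {T T′} → Balanced T →
      (∀ {w} → map part w ≡ ps → ∀ {v} → v ∈ w → T′ v ≡ T v) → ∀ q →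
      ∑tr ps (λ w → good T (q ∷ w)) xor ∑tr ps (λ w → good T′ (q ∷ w)) ≡ T q xor T′ q
    peel-difference ps ih {T} {T′} bT agree q = begin
      ∑tr ps (λ w → good T (q ∷ w)) xor ∑tr ps (λ w → good T′ (q ∷ w))
        ≡⟨ cong₂ _xor_ (∑tr-cong ps (λ {w} _ → good-∷ T q w)) (∑tr-cong ps (λ {w} tw →
             ≡.trans (good-∷ T′ q w) (cong₂ (λ s g → does (s ≟ᵇ T′ q) ∧ g)
               (sumL-cong w (agree tw)) (good-cong w (λ m → cong (adj q _ xor_) (agree tw m)))))) ⟩
      ∑tr ps (λ w → does (sumL w T ≟ᵇ T q) ∧ g w) xor ∑tr ps (λ w → does (sumL w T ≟ᵇ T′ q) ∧ g w)
        ≡⟨ sumL-xor (transversals ps) _ _ ⟨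
      ∑tr ps (λ w → (does (sumL w T ≟ᵇ T q) ∧ g w) xor (does (sumL w T ≟ᵇ T′ q) ∧ g w))
        ≡⟨ ∑tr-cong ps (λ {w} _ → ≡.trans
             (≡.sym (∧-distribʳ-xor (g w) (does (sumL w T ≟ᵇ T q)) (does (sumL w T ≟ᵇ T′ q))))
             (cong (_∧ g w) (does-≟-xor (sumL w T) (T q) (T′ q)))) ⟩
      ∑tr ps (λ w → (T q xor T′ q) ∧ g w)
        ≡⟨ sumL-scale (transversals ps) (T q xor T′ q) g ⟨
      (T q xor T′ q) ∧ goodParity ps (shift q T)
        ≡⟨ cong ((T q xor T′ q) ∧_) (ih (shift q T) (Balanced-shift q bT)) ⟩
      (T q xor T′ q) ∧ true
        ≡⟨ ∧-identityʳ _ ⟩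
      T q xor T′ q ∎
      where
      open ≡-Reasoning
      g : List (Fin N) → Bool
      g = good (shift q T)

    goodParity-flip-front : ∀ k ps → k ∉ ps → OddForBalanced ps → ∀ T → Balanced T →
      ∀ {x y} → part x ≡ k → part y ≡ k → goodParity (k ∷ ps) T ≡ goodParity (k ∷ ps) (flipPair x y T)
    goodParity-flip-front k ps k∉ps ih T bT {x} {y} px py = xor≡false⇒≡ (begin
      goodParity (k ∷ ps) T xor goodParity (k ∷ ps) T₂
        ≡⟨ cong₂ _xor_ (∑tr-∷ k ps (good T)) (∑tr-∷ k ps (good T₂)) ⟩
      sum (λ q → inBlock k q ∧ A q) xor sum (λ q → inBlock k q ∧ B q)
        ≡⟨ ∑-distrib-+ (λ q → inBlock k q ∧ A q) _ ⟨
      sum (λ q → (inBlock k q ∧ A q) xor (inBlock k q ∧ B q))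
        ≡⟨ sum-cong-≗ (λ q → ≡.trans (≡.sym (∧-distribˡ-xor (inBlock k q) (A q) (B q)))
             (cong (inBlock k q ∧_) (≡.trans (peel-difference ps ih bT agree q) (xor-cancel (T q) _)))) ⟩
      sum (λ q → inBlock k q ∧ (does (q ≟ x) xor does (q ≟ y)))
        ≡⟨ Balanced-pair (≡.trans px (≡.sym py)) k ⟩
      false ∎)
      where
      open ≡-Reasoning
      T₂ = flipPair x y T
      A B : Fin N → Bool
      A q = ∑tr ps (λ w → good T (q ∷ w))
      B q = ∑tr ps (λ w → good T₂ (q ∷ w))
      -- the transversals of ps avoid the block k, where T₂ differs from T
      agree : ∀ {w} → map part w ≡ ps → ∀ {v} → v ∈ w → T₂ v ≡ T v
      agree tw {v} v∈w = flipPair-away T (λ { refl → k∉ps (in-ps px) }) (λ { refl → k∉ps (in-ps py) })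
        where
        in-ps : part v ≡ k → k ∈ ps
        in-ps refl = subst (part v ∈_) tw (∈-map⁺ part v∈w)

    goodParity-flip : ∀ m → (∀ ps → length ps ≡ m → Unique ps → OddForBalanced ps) →
      ∀ ps → length ps ≡ suc m → Unique ps → ∀ T → Balanced T →
      ∀ {x y} → part x ≡ part y → goodParity ps T ≡ goodParity ps (flipPair x y T)
    goodParity-flip m ih ps len u T bT {x} {y} pxy with part x ∈? ps
    ... | no px∉ps = ∑tr-cong ps (λ tw → good-cong _ (λ v∈w →
            ≡.sym (flipPair-away T (away tw v∈w refl) (away tw v∈w (≡.sym pxy)))))
      where
      away : ∀ {w v z} → map part w ≡ ps → v ∈ w → part z ≡ part x → v ≢ z
      away {v = v} tw v∈w pz refl = px∉ps (subst (_∈ ps) pz (subst (part v ∈_) tw (∈-map⁺ part v∈w)))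
    ... | yes px∈ps with ∈-∃++ px∈ps
    ...   | xs , ys , refl = begin
      goodParity ps T                     ≡⟨ ∑tr-↭ (good T) good-↭ front ⟩
      goodParity (part x ∷ xs ++ ys) T    ≡⟨ goodParity-flip-front (part x) (xs ++ ys)
                                               (Unique[x∷xs]⇒x∉xs u′) (ih (xs ++ ys) len′ (AllPairs.tail u′))
                                               T bT refl (≡.sym pxy) ⟩
      goodParity (part x ∷ xs ++ ys) T₂   ≡⟨ ∑tr-↭ (good T₂) good-↭ front ⟨
      goodParity ps T₂                    ∎
      where
      open ≡-Reasoning
      T₂ = flipPair x y T
      front : ps ↭ part x ∷ xs ++ ys
      front = Perm.shift (part x) xs ys
      u′ : Unique (part x ∷ xs ++ ys)
      u′ = Unique-resp-↭ (≡.setoid (Fin n)) (↭⇒↭ₛ front) u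
      len′ : length (xs ++ ys) ≡ m
      len′ = suc-injective (≡.trans (≡.sym (Perm.↭-length front)) len)

    -- Induction on the number of blocks, and within it on the
    -- weight of T: a nonzero balanced T is reduced by switching two of its true values.
    goodParity-odd : ∀ m ps → length ps ≡ m → Unique ps → OddForBalanced ps
    goodParity-odd zero    []       _   _ T _  = refl
    goodParity-odd (suc m) (k ∷ ps) len u T bT = reduce (suc (weight T)) T ≤-refl bT
      where
      reduce : ∀ bound T → weight T < bound → Balanced T → goodParity (k ∷ ps) T ≡ true
      reduce (suc bound) T (s≤s wT) bT with any? (λ v → T v ≟ᵇ true)
      ... | no none = ≡.trans
        (∑tr-cong (k ∷ ps) (λ {w} _ → good-cong w (λ {v} _ → ¬-not (λ Tv → none (v , Tv)))))
        (goodParity-zero k ps (goodParity-odd m ps (suc-injective len) (AllPairs.tail u)))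
      ... | yes (x , Tx) =
        let (y , y≢x , pyx , Ty) = Balanced-partner bT Tx in
        ≡.trans (goodParity-flip m (goodParity-odd m) (k ∷ ps) len u T bT (≡.sym pyx))
                (reduce bound (flipPair x y T) (<-≤-trans (weight-flipPair T Tx Ty y≢x) wT)
                        (Balanced-xor bT (Balanced-pair (≡.sym pyx))))

module Setting {N n : ℕ} (part : Fin N → Fin n) (G : SimpleGraph N) where

  open Transversals part public
  open GoodTransversals part (adj G) (SimpleGraph.sym G) (irrefl G) public

  lookup-block : ∀ k v → lookup (block part k) v ≡ inBlock k v
  lookup-block k v = ≡.trans (lookup∘tabulate _ v) (⌊⌋≡does (part v ≟ k))

  ∈-block : ∀ {v i} → v ∈ₛ block part i ⇔ part v ≡ i
  ∈-block {v} {i} = mk⇔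
    (λ m → Equivalence.to (does⇔ (part v ≟ i)) (≡.trans (≡.sym (lookup-block i v)) ([]=⇒lookup m)))
    (λ e → lookup⇒[]= v (block part i) (≡.trans (lookup-block i v) (dec-true (part v ≟ i) e)))

  block-odd : (∀ i → Odd ∣ block part i ∣) → ∀ k → sum (inBlock k) ≡ true
  block-odd hodd k = begin
    sum (inBlock k)             ≡⟨ sum-cong-≗ (lookup-block k) ⟨
    sum (lookup (block part k)) ≡⟨ isOdd-∣∣ (block part k) ⟨
    isOdd ∣ block part k ∣      ≡⟨ odd-isOdd _ (hodd k) ⟩
    true                        ∎
    where open ≡-Reasoning

  own-block : (∀ i → Independent G (block part i)) → ∀ q v → inBlock (part q) v ∧ adj G q v ≡ false
  own-block hind q v with part v ≟ part q
  ... | yes e = hind (part q) q v (Equivalence.from ∈-block refl) (Equivalence.from ∈-block e)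
  ... | no _  = refl

  nbhd-balanced : (∀ i → Independent G (block part i)) →
    (∀ i j → ¬ i ≡ j → InducedEulerian G (block part i ∪ block part j)) →
    ∀ q → Balanced (adj G q)
  nbhd-balanced hind heul q k with part q ≟ k
  ... | yes refl = ≡.trans (sum-cong-≗ (own-block hind q)) (sum-replicate-zero N)
  ... | no pq≢k = begin
    sum (λ v → inBlock k v ∧ adj G q v)
      ≡⟨ sum-cong-≗ (λ v → absorb (inBlock (part q) v) (own-block hind q v)) ⟨
    sum (λ v → (inBlock (part q) v ∨ inBlock k v) ∧ adj G q v)
      ≡⟨ sum-cong-≗ (λ v → cong₂ _∧_ (≡.sym (lookup-∪ v)) (≡.sym (lookup∘tabulate (adj G q) v))) ⟩
    sum (λ v → lookup V v ∧ lookup (nbhd G q) v)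
      ≡⟨ isOdd-∣∩∣ V (nbhd G q) ⟨
    isOdd (degIn G V q)
      ≡⟨ isOdd-even _ (heul (part q) k pq≢k q (x∈p∪q⁺ (inj₁ (Equivalence.from ∈-block refl)))) ⟩
    false ∎
    where
    open ≡-Reasoning
    V = block part (part q) ∪ block part k
    lookup-∪ : ∀ v → lookup V v ≡ inBlock (part q) v ∨ inBlock k v
    lookup-∪ v = ≡.trans (lookup-zipWith _∨_ v (block part (part q)) (block part k))
                         (cong₂ _∨_ (lookup-block (part q) v) (lookup-block k v))
    absorb : ∀ a {b c} → a ∧ c ≡ false → (a ∨ b) ∧ c ≡ b ∧ c
    absorb true  {b} {false} _ = ≡.sym (∧-zeroʳ b)
    absorb false _ = refl

  Counted : Subset N → Set
  Counted U = (∀ i → ∣ U ∩ block part i ∣ ≡ 1) × InducedEulerian G U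

  Transversal : List (Fin N) → Set
  Transversal w = map part w ≡ allFin n

  transversal-unique : ∀ {w} → Transversal w → Unique w
  transversal-unique {w} tw = Unique-map⁻ (subst Unique (≡.sym tw) (allFin⁺ n))

  isOdd-degIn : ∀ {w} → Unique w → ∀ v → isOdd (degIn G (toSubset w) v) ≡ deg w v
  isOdd-degIn {w} uw v = begin
    isOdd ∣ toSubset w ∩ nbhd G v ∣
      ≡⟨ isOdd-∣∩∣ (toSubset w) (nbhd G v) ⟩
    sum (λ u → lookup (toSubset w) u ∧ lookup (nbhd G v) u)
      ≡⟨ sum-cong-≗ (λ u → cong (lookup (toSubset w) u ∧_) (lookup∘tabulate (adj G v) u)) ⟩
    sum (λ u → lookup (toSubset w) u ∧ adj G v u)
      ≡⟨ sum-toSubset w uw (adj G v) ⟩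
    deg w v ∎
    where open ≡-Reasoning

  good⇒counted : ∀ {w} → Transversal w → Good noDefect w → Counted (toSubset w)
  good⇒counted {w} tw gw = meets-once , eulerian
    where
    meets-once : ∀ i → ∣ toSubset w ∩ block part i ∣ ≡ 1
    meets-once i = ≡.trans (cong ∣_∣ (⊆-antisym ⊆⁅r⁆ ⁅r⁆⊆)) (∣⁅x⁆∣≡1 r)
      where
      r-spec = ∈-map⁻ part (subst (i ∈_) (≡.sym tw) (∈-allFin i))
      r = proj₁ r-spec
      r∈w = proj₁ (proj₂ r-spec)
      pr = ≡.sym (proj₂ (proj₂ r-spec))
      ⊆⁅r⁆ : ∀ {u} → u ∈ₛ toSubset w ∩ block part i → u ∈ₛ ⁅ r ⁆
      ⊆⁅r⁆ {u} m =
        let (u∈U , u∈Vi) = x∈p∩q⁻ (toSubset w) (block part i) m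
            u≡r = map-unique-injective part (subst Unique (≡.sym tw) (allFin⁺ n))
                    (Equivalence.to ∈-toSubset u∈U) r∈w (≡.trans (Equivalence.to ∈-block u∈Vi) (≡.sym pr))
        in subst (_∈ₛ ⁅ r ⁆) (≡.sym u≡r) (x∈⁅x⁆ r)
      ⁅r⁆⊆ : ∀ {u} → u ∈ₛ ⁅ r ⁆ → u ∈ₛ toSubset w ∩ block part i
      ⁅r⁆⊆ m with x∈⁅y⁆⇒x≡y r m
      ... | refl = x∈p∩q⁺ (Equivalence.from ∈-toSubset r∈w , Equivalence.from ∈-block pr)
    eulerian : InducedEulerian G (toSubset w)
    eulerian v v∈U = even-isOdd _ (≡.trans (isOdd-degIn (transversal-unique tw) v)
                                   (All.lookup gw (Equivalence.to ∈-toSubset v∈U)))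

  counted⇒good : ∀ {U} → Counted U → ∃ λ w → Transversal w × Good noDefect w × toSubset w ≡ U
  counted⇒good {U} (meets-once , eulerian) = w , tw , gw , w≡U
    where
    sel : Fin n → Fin N
    sel i = proj₁ (∣p∣≡1⇒singleton (U ∩ block part i) (meets-once i))
    sel-spec : ∀ i → U ∩ block part i ≡ ⁅ sel i ⁆
    sel-spec i = proj₂ (∣p∣≡1⇒singleton (U ∩ block part i) (meets-once i))
    sel∈ : ∀ i → sel i ∈ₛ U ∩ block part i
    sel∈ i = subst (sel i ∈ₛ_) (≡.sym (sel-spec i)) (x∈⁅x⁆ (sel i))
    w = map sel (allFin n)
    tw : Transversal w
    tw = ≡.trans (≡.sym (List.map-∘ (allFin n)))
           (≡.trans (List.map-cong (λ i → Equivalence.to ∈-block (proj₂ (x∈p∩q⁻ U (block part i) (sel∈ i)))) (allFin n))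
                    (List.map-id (allFin n)))
    w≡U : toSubset w ≡ U
    w≡U = ⊆-antisym ⊆U U⊆
      where
      ⊆U : ∀ {u} → u ∈ₛ toSubset w → u ∈ₛ U
      ⊆U m with ∈-map⁻ sel {xs = allFin n} (Equivalence.to ∈-toSubset m)
      ... | i , _ , refl = proj₁ (x∈p∩q⁻ U (block part i) (sel∈ i))
      U⊆ : ∀ {u} → u ∈ₛ U → u ∈ₛ toSubset w
      U⊆ {u} m = Equivalence.from ∈-toSubset (subst (_∈ w) (≡.sym u≡sel) (∈-map⁺ sel (∈-allFin (part u))))
        where
        u≡sel : u ≡ sel (part u)
        u≡sel = x∈⁅y⁆⇒x≡y (sel (part u)) (subst (u ∈ₛ_) (sel-spec (part u)) (x∈p∩q⁺ (m , Equivalence.from ∈-block refl)))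
    gw : Good noDefect w
    gw = All.tabulate (λ {v} v∈w → begin
      deg w v                          ≡⟨ isOdd-degIn (transversal-unique tw) v ⟨
      isOdd (degIn G (toSubset w) v)   ≡⟨ cong (λ U → isOdd (degIn G U v)) w≡U ⟩
      isOdd (degIn G U v)              ≡⟨ isOdd-even _ (eulerian v (subst (v ∈ₛ_) w≡U (Equivalence.from ∈-toSubset v∈w))) ⟩
      false                            ∎)
      where open ≡-Reasoning

  toSubset-injective : ∀ {w w′} → Transversal w → Transversal w′ → toSubset w ≡ toSubset w′ → w ≡ w′
  toSubset-injective {w} {w′} tw tw′ e = same-entries part (≡.trans tw (≡.sym tw′))
    (subst Unique (≡.sym tw) (allFin⁺ n))
    (λ m → Equivalence.to ∈-toSubset (subst (_ ∈ₛ_) e (Equivalence.from ∈-toSubset m)))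

  goodTransversals : List (List (Fin N))
  goodTransversals = filter (good? noDefect) (transversals (allFin n))

  ∈-goodTransversals : ∀ {w} → w ∈ goodTransversals ⇔ (Transversal w × Good noDefect w)
  ∈-goodTransversals = mk⇔
    (λ m → let (m′ , g) = ∈-filter⁻ (good? noDefect) m in Equivalence.to (∈-transversals _) m′ , g)
    (λ (t , g) → ∈-filter⁺ (good? noDefect) (Equivalence.from (∈-transversals _) t) g)

  countedSubsets : List (Subset N)
  countedSubsets = map toSubset goodTransversals

  ∈-countedSubsets : ∀ {U} → U ∈ countedSubsets ⇔ Counted U
  ∈-countedSubsets = mk⇔ sound complete
    where
    sound : ∀ {U} → U ∈ countedSubsets → Counted U
    sound m with ∈-map⁻ toSubset m
    ... | w , w∈ , refl = let (t , g) = Equivalence.to ∈-goodTransversals w∈ in good⇒counted t g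
    complete : ∀ {U} → Counted U → U ∈ countedSubsets
    complete c with counted⇒good c
    ... | w , t , g , refl = ∈-map⁺ toSubset (Equivalence.from ∈-goodTransversals (t , g))

  countedSubsets-unique : Unique countedSubsets
  countedSubsets-unique = AllPairs.map⁺ (AllPairs-strengthen (λ t t′ w≢w′ e → w≢w′ (toSubset-injective t t′ e))
    (All.tabulate (λ m → proj₁ (Equivalence.to ∈-goodTransversals m)))
    (filter⁺ (good? noDefect) (transversals-unique (allFin n))))

  countedSubsets-odd : (∀ i → Odd ∣ block part i ∣) → (∀ i → Independent G (block part i)) →
    (∀ i j → ¬ i ≡ j → InducedEulerian G (block part i ∪ block part j)) →
    isOdd (length countedSubsets) ≡ true
  countedSubsets-odd hodd hind heul = begin
    isOdd (length countedSubsets)   ≡⟨ cong isOdd (List.length-map toSubset goodTransversals) ⟩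
    isOdd (length goodTransversals) ≡⟨ isOdd-filter (good? noDefect) (transversals (allFin n)) ⟩
    goodParity (allFin n) noDefect  ≡⟨ goodParity-odd (block-odd hodd) (nbhd-balanced hind heul)
                                         n (allFin n) (List.length-tabulate (λ i → i)) (allFin⁺ n)
                                         noDefect Balanced-zero ⟩
    true                            ∎
    where open ≡-Reasoning

mainTheorem1 : (N n : ℕ) (part : Fin N → Fin n) (G : SimpleGraph N) →
    (∀ i → Odd ∣ block part i ∣) →
    (∀ i → Independent G (block part i)) →
    (∀ i j → ¬ i ≡ j → InducedEulerian G (block part i ∪ block part j)) →
    Σ ℕ λ m → Odd m × HasCount (λ (U : Subset N) → (∀ i → ∣ U ∩ block part i ∣ ≡ 1) × InducedEulerian G U) m
mainTheorem1 N n part G hodd hind heul =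
  length countedSubsets ,
  isOdd-odd _ (countedSubsets-odd hodd hind heul) ,
  countedSubsets , countedSubsets-unique , (λ U → ∈-countedSubsets) , refl
  where open Setting part G
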